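{- Let $n\geq 0$, $r\geq 1$, $k\geq 0$ be integers. Let $M(n,r,k)$ be the number of binary words of length $n$ which (if $n>0$) begin with $0$ and contain exactly $k$ maximal runs of $1$s of length exactly $r$, and let $N(n,r+1,k)$ be the number of binary words of length $n$ which (if $n>0$) begin with $0$ and contain exactly $k$ maximal runs (of either symbol) of length exactly $r+1$. Then $M(n,r,k)=N(n,r+1,k)$.
   Context: A binary word is a finite sequence of symbols from $\{0,1\}$. A maximal run in a binary word is a maximal consecutive subword consisting of identical symbols; a maximal run of $1$s is a maximal run consisting of the symbol $1$. The length of a run is its number of symbols. For $n=0$ the only word counted is the empty word, which has no runs. -}

module Defs where

open import Data.Nat using (ℕ; zero; suc; _≟_)
open import Data.Bool using (Bool; true; false; _∧_; if_then_else_) renaming (_≟_ to _≟B_)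
open import Data.List using (List; []; _∷_; length; filter; map; _++_)
open import Data.Product using (_×_; _,_)
open import Relation.Nullary using (Dec; yes; no)
open import Relation.Nullary.Decidable using (⌊_⌋)
open import Relation.Binary.PropositionalEquality using (_≡_)

-- A binary word: a list of Booleans (false = 0, true = 1).
Word : Set
Word = List Bool

words : ℕ → List Word
words zero = [] ∷ []
words (suc n) = map (false ∷_) (words n) ++ map (true ∷_) (words n)

runs : Word → List (Bool × ℕ)
runs [] = []
runs (b ∷ w) with runs w
... | [] = (b , 1) ∷ []
... | (c , m) ∷ rs = if ⌊ b ≟B c ⌋ then (c , suc m) ∷ rs else (b , 1) ∷ (c , m) ∷ rs

count1Runs : ℕ → Word → ℕ
count1Runs r w = length (filter (λ { (s , m) → s ≟B true }) (filter (λ { (s , m) → m ≟ r }) (runs w)))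

countRuns : ℕ → Word → ℕ
countRuns r w = length (filter (λ { (s , m) → m ≟ r }) (runs w))

startsOK : Word → Bool
startsOK [] = true
startsOK (b ∷ _) = ⌊ b ≟B false ⌋

M : ℕ → ℕ → ℕ → ℕ
M n r k = length (filter (λ w → startsOK w ≟B true) (filter (λ w → count1Runs r w ≟ k) (words n)))

N : ℕ → ℕ → ℕ → ℕ
N n s k = length (filter (λ w → startsOK w ≟B true) (filter (λ w → countRuns s w ≟ k) (words n)))

-- Send a word x₁x₂…xₙ to 0y₂…yₙ with yᵢ = 1 iff xᵢ = xᵢ₋₁. This is a bijection between
-- words of length n beginning with 0, and a maximal run of length L of x becomes a 0
-- followed by L − 1 ones, so runs of length r + 1 in x correspond exactly to maximal
-- runs of 1s of length r in the image.
module Submission where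

open import Defs
open import Data.Nat using (ℕ; zero; suc; _≥_; _+_; _≟_; s≤s)
open import Data.Nat.Properties using (+-comm)
open import Data.Bool using (Bool; true; false; _∧_; if_then_else_) renaming (_≟_ to _≟B_)
open import Data.Bool.Properties using (∧-identityʳ; ∧-zeroʳ)
open import Data.List using (List; []; _∷_; length; filter; map; _++_)
open import Data.Product using (_×_; _,_)
open import Function using (_∘_)
open import Level using (Level)
open import Relation.Nullary using (does)
open import Relation.Nullary.Decidable using (⌊_⌋)
open import Relation.Unary using (Pred; Decidable)
open import Relation.Binary.PropositionalEquality
  using (_≡_; _≗_; refl; trans; cong; cong₂; module ≡-Reasoning)

countᵇ : {A : Set} → (A → Bool) → List A → ℕ
countᵇ p [] = 0
countᵇ p (x ∷ xs) = if p x then suc (countᵇ p xs) else countᵇ p xs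

module _ {A : Set} where

  countᵇ-cong : {p q : A → Bool} → p ≗ q → ∀ xs → countᵇ p xs ≡ countᵇ q xs
  countᵇ-cong p≗q [] = refl
  countᵇ-cong {q = q} p≗q (x ∷ xs) rewrite p≗q x with q x
  ... | true  = cong suc (countᵇ-cong p≗q xs)
  ... | false = countᵇ-cong p≗q xs

  countᵇ-false : ∀ xs → countᵇ {A} (λ _ → false) xs ≡ 0
  countᵇ-false [] = refl
  countᵇ-false (x ∷ xs) = countᵇ-false xs

  countᵇ-++ : (p : A → Bool) (xs ys : List A) → countᵇ p (xs ++ ys) ≡ countᵇ p xs + countᵇ p ys
  countᵇ-++ p [] ys = refl
  countᵇ-++ p (x ∷ xs) ys with p x
  ... | true  = cong suc (countᵇ-++ p xs ys)
  ... | false = countᵇ-++ p xs ys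

  countᵇ-map : {B : Set} (p : B → Bool) (f : A → B) (xs : List A) →
               countᵇ p (map f xs) ≡ countᵇ (p ∘ f) xs
  countᵇ-map p f [] = refl
  countᵇ-map p f (x ∷ xs) with p (f x)
  ... | true  = cong suc (countᵇ-map p f xs)
  ... | false = countᵇ-map p f xs

  length-filter : {ℓ : Level} {P : Pred A ℓ} (P? : Decidable P) (xs : List A) →
                  length (filter P? xs) ≡ countᵇ (does ∘ P?) xs
  length-filter P? [] = refl
  length-filter P? (x ∷ xs) with does (P? x)
  ... | true  = cong suc (length-filter P? xs)
  ... | false = length-filter P? xs

  countᵇ-filter : (p : A → Bool) {ℓ : Level} {P : Pred A ℓ} (P? : Decidable P) (xs : List A) →
                  countᵇ p (filter P? xs) ≡ countᵇ (λ x → p x ∧ does (P? x)) xs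
  countᵇ-filter p P? [] = refl
  countᵇ-filter p P? (x ∷ xs) with does (P? x)
  ... | true  rewrite ∧-identityʳ (p x) with p x
  ...   | true  = cong suc (countᵇ-filter p P? xs)
  ...   | false = countᵇ-filter p P? xs
  countᵇ-filter p P? (x ∷ xs) | false rewrite ∧-zeroʳ (p x) = countᵇ-filter p P? xs

  length-filter-filter : {ℓ : Level} {P Q : Pred A ℓ} (P? : Decidable P) (Q? : Decidable Q) (xs : List A) →
                         length (filter P? (filter Q? xs)) ≡ countᵇ (λ x → does (P? x) ∧ does (Q? x)) xs
  length-filter-filter P? Q? xs = trans (length-filter P? (filter Q? xs)) (countᵇ-filter (does ∘ P?) Q? xs)

countᵇ-words-suc : (p : Word → Bool) (n : ℕ) →
  countᵇ p (words (suc n)) ≡ countᵇ (p ∘ (false ∷_)) (words n) + countᵇ (p ∘ (true ∷_)) (words n)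
countᵇ-words-suc p n = trans (countᵇ-++ p (map (false ∷_) (words n)) (map (true ∷_) (words n)))
                             (cong₂ _+_ (countᵇ-map p _ (words n)) (countᵇ-map p _ (words n)))

agreements : Bool → Word → Word
agreements b [] = []
agreements b (c ∷ w) = ⌊ b ≟B c ⌋ ∷ agreements c w

countᵇ-words-agreements : (n : ℕ) (p : Word → Bool) (b : Bool) →
                          countᵇ (p ∘ agreements b) (words n) ≡ countᵇ p (words n)
countᵇ-words-agreements zero p b = refl
countᵇ-words-agreements (suc n) p false = begin
  countᵇ (p ∘ agreements false) (words (suc n))
    ≡⟨ countᵇ-words-suc (p ∘ agreements false) n ⟩
  countᵇ (p ∘ agreements false ∘ (false ∷_)) (words n) + countᵇ (p ∘ agreements false ∘ (true ∷_)) (words n)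
    ≡⟨ cong₂ _+_ (countᵇ-words-agreements n (p ∘ (true ∷_)) false)
                 (countᵇ-words-agreements n (p ∘ (false ∷_)) true) ⟩
  countᵇ (p ∘ (true ∷_)) (words n) + countᵇ (p ∘ (false ∷_)) (words n)
    ≡⟨ +-comm (countᵇ (p ∘ (true ∷_)) (words n)) _ ⟩
  countᵇ (p ∘ (false ∷_)) (words n) + countᵇ (p ∘ (true ∷_)) (words n)
    ≡⟨ countᵇ-words-suc p n ⟨
  countᵇ p (words (suc n)) ∎
  where open ≡-Reasoning
countᵇ-words-agreements (suc n) p true = begin
  countᵇ (p ∘ agreements true) (words (suc n))
    ≡⟨ countᵇ-words-suc (p ∘ agreements true) n ⟩
  countᵇ (p ∘ agreements true ∘ (false ∷_)) (words n) + countᵇ (p ∘ agreements true ∘ (true ∷_)) (words n)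
    ≡⟨ cong₂ _+_ (countᵇ-words-agreements n (p ∘ (false ∷_)) false)
                 (countᵇ-words-agreements n (p ∘ (true ∷_)) true) ⟩
  countᵇ (p ∘ (false ∷_)) (words n) + countᵇ (p ∘ (true ∷_)) (words n)
    ≡⟨ countᵇ-words-suc p n ⟨
  countᵇ p (words (suc n)) ∎
  where open ≡-Reasoning

Run : Set
Run = Bool × ℕ

consRun : Bool → List Run → List Run
consRun b [] = (b , 1) ∷ []
consRun b ((c , m) ∷ rs) = if ⌊ b ≟B c ⌋ then (c , suc m) ∷ rs else (b , 1) ∷ (c , m) ∷ rs

runs-∷ : (b : Bool) (w : Word) → runs (b ∷ w) ≡ consRun b (runs w)
runs-∷ b w with runs w
... | []           = refl
... | (c , m) ∷ rs = refl

-- The runs of the word cᵐ w.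
runsFrom : Bool → ℕ → Word → List Run
runsFrom c m [] = (c , m) ∷ []
runsFrom c m (d ∷ w) = if ⌊ c ≟B d ⌋ then runsFrom c (suc m) w else (c , m) ∷ runsFrom d 1 w

consRun-runsFrom : (c d : Bool) (m : ℕ) (w : Word) →
  consRun c (runsFrom d m w) ≡ (if ⌊ c ≟B d ⌋ then runsFrom d (suc m) w else (c , 1) ∷ runsFrom d m w)
consRun-runsFrom c true  m (true  ∷ w) = consRun-runsFrom c true  (suc m) w
consRun-runsFrom c false m (false ∷ w) = consRun-runsFrom c false (suc m) w
consRun-runsFrom true  true  m []          = refl
consRun-runsFrom true  false m []          = refl
consRun-runsFrom false true  m []          = refl
consRun-runsFrom false false m []          = refl
consRun-runsFrom true  true  m (false ∷ w) = refl
consRun-runsFrom false true  m (false ∷ w) = refl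
consRun-runsFrom true  false m (true  ∷ w) = refl
consRun-runsFrom false false m (true  ∷ w) = refl

runs≡runsFrom : (b : Bool) (w : Word) → runs (b ∷ w) ≡ runsFrom b 1 w
runs≡runsFrom b [] = refl
runs≡runsFrom b (d ∷ w) = begin
  runs (b ∷ d ∷ w)                   ≡⟨ runs-∷ b (d ∷ w) ⟩
  consRun b (runs (d ∷ w))           ≡⟨ cong (consRun b) (runs≡runsFrom d w) ⟩
  consRun b (runsFrom d 1 w)         ≡⟨ consRun-runsFrom b d 1 w ⟩
  (if ⌊ b ≟B d ⌋ then runsFrom d 2 w else (b , 1) ∷ runsFrom d 1 w)
                                     ≡⟨ runsFrom-step b d ⟩
  runsFrom b 1 (d ∷ w)               ∎
  where
  open ≡-Reasoning
  runsFrom-step : ∀ b d → (if ⌊ b ≟B d ⌋ then runsFrom d 2 w else (b , 1) ∷ runsFrom d 1 w)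
                          ≡ runsFrom b 1 (d ∷ w)
  runsFrom-step true  true  = refl
  runsFrom-step true  false = refl
  runsFrom-step false true  = refl
  runsFrom-step false false = refl

hasLength : ℕ → Run → Bool
hasLength s (_ , m) = does (m ≟ s)

isOnesOfLength : ℕ → Run → Bool
isOnesOfLength s (b , m) = does (b ≟B true) ∧ does (m ≟ s)

countRuns-runsFrom : (s : ℕ) (b : Bool) (w : Word) →
                     countRuns s (b ∷ w) ≡ countᵇ (hasLength s) (runsFrom b 1 w)
countRuns-runsFrom s b w = trans (length-filter _ (runs (b ∷ w))) (cong (countᵇ (hasLength s)) (runs≡runsFrom b w))

count1Runs-runsFrom : (s : ℕ) (b : Bool) (w : Word) →
                      count1Runs s (b ∷ w) ≡ countᵇ (isOnesOfLength s) (runsFrom b 1 w)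
count1Runs-runsFrom s b w = trans (length-filter-filter _ _ (runs (b ∷ w)))
                                  (cong (countᵇ (isOnesOfLength s)) (runs≡runsFrom b w))

-- Reading agreements c w after a prefix 1^(m+1) (resp. 0^j) corresponds to reading w
-- inside a run of length m + 2 (resp. at the start of a run) of c.
mutual
  onesRuns-agreements-inRun : (r m : ℕ) (c : Bool) (w : Word) →
    countᵇ (isOnesOfLength (suc r)) (runsFrom true (suc m) (agreements c w))
      ≡ countᵇ (hasLength (suc (suc r))) (runsFrom c (suc (suc m)) w)
  onesRuns-agreements-inRun r m c [] = refl
  onesRuns-agreements-inRun r m true  (true  ∷ w) = onesRuns-agreements-inRun r (suc m) true w
  onesRuns-agreements-inRun r m false (false ∷ w) = onesRuns-agreements-inRun r (suc m) false w
  onesRuns-agreements-inRun r m true  (false ∷ w) =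
    cong (λ n → if does (m ≟ r) then suc n else n) (onesRuns-agreements-atStart r 1 false w)
  onesRuns-agreements-inRun r m false (true  ∷ w) =
    cong (λ n → if does (m ≟ r) then suc n else n) (onesRuns-agreements-atStart r 1 true w)

  onesRuns-agreements-atStart : (r j : ℕ) (c : Bool) (w : Word) →
    countᵇ (isOnesOfLength (suc r)) (runsFrom false j (agreements c w))
      ≡ countᵇ (hasLength (suc (suc r))) (runsFrom c 1 w)
  onesRuns-agreements-atStart r j c [] = refl
  onesRuns-agreements-atStart r j true  (true  ∷ w) = onesRuns-agreements-inRun r 0 true w
  onesRuns-agreements-atStart r j false (false ∷ w) = onesRuns-agreements-inRun r 0 false w
  onesRuns-agreements-atStart r j true  (false ∷ w) = onesRuns-agreements-atStart r (suc j) false w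
  onesRuns-agreements-atStart r j false (true  ∷ w) = onesRuns-agreements-atStart r (suc j) true w

count1Runs-agreements : (r : ℕ) (b : Bool) (w : Word) →
                        count1Runs (suc r) (false ∷ agreements b w) ≡ countRuns (suc (suc r)) (b ∷ w)
count1Runs-agreements r b w = begin
  count1Runs (suc r) (false ∷ agreements b w)                        ≡⟨ count1Runs-runsFrom (suc r) false (agreements b w) ⟩
  countᵇ (isOnesOfLength (suc r)) (runsFrom false 1 (agreements b w)) ≡⟨ onesRuns-agreements-atStart r 1 b w ⟩
  countᵇ (hasLength (suc (suc r))) (runsFrom b 1 w)                  ≡⟨ countRuns-runsFrom (suc (suc r)) b w ⟨
  countRuns (suc (suc r)) (b ∷ w)                                    ∎
  where open ≡-Reasoning

countStartingWith0 : (f : Word → ℕ) (k n : ℕ) →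
  length (filter (λ w → startsOK w ≟B true) (filter (λ w → f w ≟ k) (words (suc n))))
    ≡ countᵇ (λ w → does (f (false ∷ w) ≟ k)) (words n)
countStartingWith0 f k n = begin
  length (filter (λ w → startsOK w ≟B true) (filter (λ w → f w ≟ k) (words (suc n))))
    ≡⟨ length-filter-filter _ _ (words (suc n)) ⟩
  countᵇ (λ w → does (startsOK w ≟B true) ∧ does (f w ≟ k)) (words (suc n))
    ≡⟨ countᵇ-words-suc _ n ⟩
  countᵇ (λ w → does (f (false ∷ w) ≟ k)) (words n) + countᵇ (λ _ → false) (words n)
    ≡⟨ cong (countᵇ (λ w → does (f (false ∷ w) ≟ k)) (words n) +_) (countᵇ-false (words n)) ⟩
  countᵇ (λ w → does (f (false ∷ w) ≟ k)) (words n) + 0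
    ≡⟨ +-comm _ 0 ⟩
  countᵇ (λ w → does (f (false ∷ w) ≟ k)) (words n) ∎
  where open ≡-Reasoning

mainTheorem2 : (n r k : ℕ) → r ≥ 1 → M n r k ≡ N n (suc r) k
mainTheorem2 zero _ zero    _ = refl
mainTheorem2 zero _ (suc k) _ = refl
mainTheorem2 (suc n) (suc r) k (s≤s _) = begin
  M (suc n) (suc r) k
    ≡⟨ countStartingWith0 (count1Runs (suc r)) k n ⟩
  countᵇ (λ w → does (count1Runs (suc r) (false ∷ w) ≟ k)) (words n)
    ≡⟨ countᵇ-words-agreements n (λ w → does (count1Runs (suc r) (false ∷ w) ≟ k)) false ⟨
  countᵇ (λ w → does (count1Runs (suc r) (false ∷ agreements false w) ≟ k)) (words n)
    ≡⟨ countᵇ-cong (λ w → cong (λ c → does (c ≟ k)) (count1Runs-agreements r false w)) (words n) ⟩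
  countᵇ (λ w → does (countRuns (suc (suc r)) (false ∷ w) ≟ k)) (words n)
    ≡⟨ countStartingWith0 (countRuns (suc (suc r))) k n ⟨
  N (suc n) (suc (suc r)) k ∎
  where open ≡-Reasoning
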